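{- Let $E$ be a finite set, let $S\subseteq 2^E$, and let $e\in E$ be a loop of $S$, i.e. $e\notin Y$ for every $Y\in S$. If $S/e:=\{X\subseteq E\setminus\{e\}\mid X\in S\}$ is a powerful set (with ground set $E\setminus\{e\}$), then $S$ is a powerful set.
   Context: For a finite ground set $E$, a family $S\subseteq 2^E$ is called a powerful set if for every $X\subseteq E$ the number of members $Y\in S$ with $Y\cap X=\emptyset$ is a power of $2$. -}

module Defs where

open import Data.Nat using (ℕ; zero; suc; _+_; _^_)
open import Data.Bool using (Bool; true; false; _∧_; _∨_; not; if_then_else_)
open import Data.Vec using (Vec; []; _∷_; map; _++_; insertAt; foldr)
open import Data.Fin using (Fin)
open import Data.Fin.Subset using (Subset; _∩_; _∉_)
open import Data.Product using (Σ)
open import Relation.Binary.PropositionalEquality using (_≡_)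
import Data.List as L

Family : ℕ → Set
Family n = Subset n → Bool

allSubsets : (n : ℕ) → L.List (Subset n)
allSubsets zero = [] L.∷ L.[]
allSubsets (suc n) = L.map (false ∷_) (allSubsets n) L.++ L.map (true ∷_) (allSubsets n)

isEmpty : ∀ {n} → Subset n → Bool
isEmpty [] = true
isEmpty (b ∷ p) = not b ∧ isEmpty p

disjoint : ∀ {n} → Subset n → Subset n → Bool
disjoint Y X = isEmpty (Y ∩ X)

countDisjoint : ∀ {n} → Family n → Subset n → ℕ
countDisjoint {n} S X = L.length (L.filterᵇ (λ Y → S Y ∧ disjoint Y X) (allSubsets n))

Powerful : ∀ {n} → Family n → Set
Powerful {n} S = (X : Subset n) → Σ ℕ (λ k → countDisjoint S X ≡ 2 ^ k)

IsLoop : ∀ {n} → Family n → Fin n → Set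
IsLoop {n} S e = (Y : Subset n) → S Y ≡ true → e ∉ Y

-- Contraction S/e on ground set E ∖ {e}, identified with Fin n via punchIn e:
-- a subset X of E ∖ {e} is sent to the subset of E obtained by inserting
-- "false" at position e, and X ∈ S/e iff that subset is in S.
contract : ∀ {n} → Family (suc n) → Fin (suc n) → Family n
contract S e X = S (insertAt X e false)

-- Count the members of S disjoint from X by splitting the subsets Y of E
-- according to whether e ∈ Y.  As e is a loop, no member of S contains e, and
-- a set Y ∌ e is disjoint from X exactly when it is disjoint from X ∖ {e}.  So
-- the count for (S, X) equals the count for (S/e, X ∖ {e}), a power of 2.
module Submission where

open import Defs
open import Data.Nat using (ℕ; suc; _+_)
open import Data.Nat.Properties using (+-identityʳ; +-commutativeSemigroup)
open import Algebra.Properties.CommutativeSemigroup +-commutativeSemigroup using (interchange)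
open import Data.Bool using (Bool; true; false; T; _∧_; not)
open import Data.Fin using (Fin; zero; suc)
open import Data.Fin.Subset using (Subset)
open import Data.Vec using (_∷_; insertAt; removeAt)
open import Data.Vec.Properties using (insertAt-lookup; lookup⇒[]=)
open import Data.List using (List; []; length; map; _++_; filterᵇ)
import Data.List as List
open import Data.List.Properties using (length-++; filter-++; filter-≐; filter-none)
open import Data.List.Relation.Unary.All using (universal)
open import Data.Product using (_,_)
open import Data.Empty using (⊥-elim)
open import Function using (_∘_)
open import Relation.Binary.PropositionalEquality
  using (_≡_; _≗_; refl; sym; trans; cong; cong₂; subst; module ≡-Reasoning)

countᵇ : {A : Set} → (A → Bool) → List A → ℕ
countᵇ p = length ∘ filterᵇ p

module _ {A : Set} where

  countᵇ-++ : (p : A → Bool) (xs ys : List A) →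
              countᵇ p (xs ++ ys) ≡ countᵇ p xs + countᵇ p ys
  countᵇ-++ p xs ys = trans (cong length (filter-++ _ xs ys)) (length-++ (filterᵇ p xs))

  countᵇ-cong : {p q : A → Bool} → p ≗ q → countᵇ p ≗ countᵇ q
  countᵇ-cong p≗q =
    cong length ∘ filter-≐ _ _ ((λ {x} → subst T (p≗q x)) , (λ {x} → subst T (sym (p≗q x))))

  countᵇ-none : {p : A → Bool} → (∀ x → p x ≡ false) → ∀ xs → countᵇ p xs ≡ 0
  countᵇ-none p≡false xs =
    cong length (filter-none _ (universal (λ x → subst T (p≡false x)) xs))

countᵇ-map : {A B : Set} (p : B → Bool) (f : A → B) (xs : List A) →
             countᵇ p (map f xs) ≡ countᵇ (p ∘ f) xs
countᵇ-map p f []       = refl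
countᵇ-map p f (x List.∷ xs) with p (f x)
... | true  = cong suc (countᵇ-map p f xs)
... | false = countᵇ-map p f xs

countSubsets : ∀ {n} → (Subset n → Bool) → ℕ
countSubsets {n} p = countᵇ p (allSubsets n)

countSubsets-∷ : ∀ {n} (p : Subset (suc n) → Bool) →
                 countSubsets p ≡ countSubsets (p ∘ (false ∷_)) + countSubsets (p ∘ (true ∷_))
countSubsets-∷ {n} p = begin
  countᵇ p (map (false ∷_) (allSubsets n) ++ map (true ∷_) (allSubsets n))
    ≡⟨ countᵇ-++ p (map (false ∷_) (allSubsets n)) (map (true ∷_) (allSubsets n)) ⟩
  countᵇ p (map (false ∷_) (allSubsets n)) + countᵇ p (map (true ∷_) (allSubsets n))
    ≡⟨ cong₂ _+_ (countᵇ-map p (false ∷_) (allSubsets n)) (countᵇ-map p (true ∷_) (allSubsets n)) ⟩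
  countSubsets (p ∘ (false ∷_)) + countSubsets (p ∘ (true ∷_))  ∎
  where open ≡-Reasoning

countSubsets-insertAt : ∀ {n} (i : Fin (suc n)) (p : Subset (suc n) → Bool) →
  countSubsets p ≡ countSubsets (λ Z → p (insertAt Z i false)) + countSubsets (λ Z → p (insertAt Z i true))
countSubsets-insertAt zero p = countSubsets-∷ p
countSubsets-insertAt {suc n} (suc i) p = begin
  countSubsets p
    ≡⟨ countSubsets-∷ p ⟩
  countSubsets (p ∘ (false ∷_)) + countSubsets (p ∘ (true ∷_))
    ≡⟨ cong₂ _+_ (countSubsets-insertAt i (p ∘ (false ∷_))) (countSubsets-insertAt i (p ∘ (true ∷_))) ⟩
  (count false false + count false true) + (count true false + count true true)
    ≡⟨ interchange (count false false) (count false true) (count true false) (count true true) ⟩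
  (count false false + count true false) + (count false true + count true true)
    ≡⟨ sym (cong₂ _+_ (countSubsets-∷ (λ Z → p (insertAt Z (suc i) false)))
                      (countSubsets-∷ (λ Z → p (insertAt Z (suc i) true)))) ⟩
  countSubsets (λ Z → p (insertAt Z (suc i) false)) + countSubsets (λ Z → p (insertAt Z (suc i) true))  ∎
  where
  open ≡-Reasoning
  count : Bool → Bool → ℕ
  count x v = countSubsets (λ Z → p (x ∷ insertAt Z i v))

disjoint-insertAt-false : ∀ {n} (i : Fin (suc n)) (Z : Subset n) (X : Subset (suc n)) →
                          disjoint (insertAt Z i false) X ≡ disjoint Z (removeAt X i)
disjoint-insertAt-false zero          Z       (x ∷ X)         = refl
disjoint-insertAt-false {suc n} (suc i) (z ∷ Z) (x ∷ X@(_ ∷ _)) =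
  cong (not (z ∧ x) ∧_) (disjoint-insertAt-false i Z X)

loop⇒∉-insertAt-true : ∀ {n} {S : Family (suc n)} {e : Fin (suc n)} → IsLoop S e →
                        (Z : Subset n) → S (insertAt Z e true) ≡ false
loop⇒∉-insertAt-true {S = S} {e} loop Z with S (insertAt Z e true) in S∋Y
... | false = refl
... | true  = ⊥-elim (loop _ S∋Y (lookup⇒[]= e _ (insertAt-lookup Z e true)))

countDisjoint-contract : ∀ {n} (S : Family (suc n)) (e : Fin (suc n)) → IsLoop S e →
  (X : Subset (suc n)) → countDisjoint S X ≡ countDisjoint (contract S e) (removeAt X e)
countDisjoint-contract {n} S e loop X = begin
  countSubsets p
    ≡⟨ countSubsets-insertAt e p ⟩
  countSubsets (λ Z → p (insertAt Z e false)) + countSubsets (λ Z → p (insertAt Z e true))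
    ≡⟨ cong₂ _+_ (countᵇ-cong without-e (allSubsets n)) (countᵇ-none with-e (allSubsets n)) ⟩
  countDisjoint (contract S e) (removeAt X e) + 0
    ≡⟨ +-identityʳ _ ⟩
  countDisjoint (contract S e) (removeAt X e)  ∎
  where
  open ≡-Reasoning
  p : Subset (suc n) → Bool
  p Y = S Y ∧ disjoint Y X
  without-e : ∀ Z → p (insertAt Z e false) ≡ (contract S e Z ∧ disjoint Z (removeAt X e))
  without-e Z = cong (S (insertAt Z e false) ∧_) (disjoint-insertAt-false e Z X)
  with-e : ∀ Z → p (insertAt Z e true) ≡ false
  with-e Z = cong (_∧ disjoint (insertAt Z e true) X) (loop⇒∉-insertAt-true loop Z)

theorem2 : (n : ℕ) (S : Family (suc n)) (e : Fin (suc n)) →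
    IsLoop S e → Powerful (contract S e) → Powerful S
theorem2 n S e loop powerful X with powerful (removeAt X e)
... | k , count≡2^k = k , trans (countDisjoint-contract S e loop X) count≡2^k
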